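{- Let $m$ be a positive integer and let $x^1,\dots,x^k$ be circuits of the matrix $(1,1,1)^{(m)}$. Suppose that $\sum_{i=1}^k h_i x^i=0$ is a primitive relation. Then the Graver complexity of $(1,1,1)^{(m)}$ satisfies $g\left((1,1,1)^{(m)}\right)\geq \sum_{i=1}^k h_i$.
   Context: $(1,1,1)^{(m)}$ denotes the $(3+m)\times 3m$ vertex-edge incidence matrix of the complete bipartite graph $K_{3,m}$; equivalently it is the $m$-fold product of the $1\times 3$ matrix $(1,1,1)$, where for an $s\times t$ matrix $A$ the $n$-fold product $A^{(n)}$ is the $(t+ns)\times nt$ block matrix whose first block row is $(I_t,\dots,I_t)$ ($n$ copies of the identity) followed by the block-diagonal matrix with $n$ copies of $A$. A circuit of an integer matrix $B$ is a nonzero integer vector $x$ with $Bx=0$ whose support is inclusion-minimal among such vectors and whose nonzero entries are relatively prime. A linear relation $\sum_{i=1}^k h_iv^i=0$ on integer vectors $v^1,\dots,v^k$ is primitive if $h_1,\dots,h_k$ are relatively prime positive integers and no $k-1$ of the $v^i$ satisfy any nontrivial linear relation. On $\mathbb{Z}^N$, $u\sqsubseteq v$ means $|u_i|\le|v_i|$ and $u_iv_i\ge0$ for all $i$; the Graver basis $\mathcal{G}(B)$ is the set of $\sqsubseteq$-minimal elements of $\{x\in\mathbb{Z}^N:Bx=0,\ x\ne0\}$. For $x\in\mathbb{Z}^{nt}$ written in blocks $x=(x^1,\dots,x^n)$, $x^i\in\mathbb{Z}^t$, $\mathrm{type}(x)$ is the number of nonzero blocks. The Graver complexity of an $s\times t$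 matrix $A$ is $g(A):=\sup\left(\{0\}\cup\{\mathrm{type}(x):x\in\bigcup_{n\ge1}\mathcal{G}(A^{(n)})\}\right)$. -}

module Defs where

open import Data.Nat using (ℕ; zero; suc; _≤_) renaming (_+_ to _+ℕ_; _*_ to _*ℕ_)
open import Data.Integer using (ℤ; +_; _+_; _*_; ∣_∣)
open import Data.Fin using (Fin; zero; suc; splitAt; remQuot; combine)
import Data.Fin as Fin
open import Data.Bool using (Bool; true; false; if_then_else_; _∨_; not)
open import Data.Sum using (_⊎_; inj₁; inj₂)
open import Data.Product using (Σ; _×_; _,_)
open import Data.Nat.Divisibility using (_∣_)
open import Relation.Binary.PropositionalEquality using (_≡_)
open import Relation.Nullary using (¬_; does)
open import Data.Empty using (⊥)

Vector : ℕ → Set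
Vector n = Fin n → ℤ

Matrix : ℕ → ℕ → Set
Matrix s t = Fin s → Fin t → ℤ

∑ : ∀ {n} → (Fin n → ℤ) → ℤ
∑ {zero}  f = + 0
∑ {suc n} f = f zero + ∑ (λ i → f (suc i))

_·_ : ∀ {s t} → Matrix s t → Vector t → Vector s
(A · x) i = ∑ (λ j → A i j * x j)

IsZero : ∀ {n} → Vector n → Set
IsZero x = ∀ i → x i ≡ + 0

InKernel : ∀ {s t} → Matrix s t → Vector t → Set
InKernel B x = IsZero (B · x)

SuppSub : ∀ {n} → Vector n → Vector n → Set
SuppSub y x = ∀ i → ¬ (y i ≡ + 0) → ¬ (x i ≡ + 0)

RelPrime : ∀ {n} → (Fin n → ℕ) → Set
RelPrime a = ∀ (d : ℕ) → (∀ i → d ∣ a i) → d ≡ 1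

IsCircuit : ∀ {s t} → Matrix s t → Vector t → Set
IsCircuit B x =
  ¬ IsZero x × InKernel B x
  × (∀ y → ¬ IsZero y → InKernel B y → SuppSub y x → SuppSub x y)
  × RelPrime (λ i → ∣ x i ∣)

LinComb : ∀ {k N} → (Fin k → ℤ) → (Fin k → Vector N) → Vector N
LinComb c v j = ∑ (λ i → c i * v i j)

IsPrimitiveRelation : ∀ {k N} → (Fin k → ℕ) → (Fin k → Vector N) → Set
IsPrimitiveRelation {k} h v =
  (∀ i → 1 ≤ h i) × RelPrime h
  × IsZero (LinComb (λ i → + (h i)) v)
  -- no k-1 of the v^i (i.e. the family omitting index j) satisfy a nontrivial linear relation
  × (∀ (j : Fin k) (c : Fin k → ℤ) → c j ≡ + 0 → ¬ IsZero c → ¬ IsZero (LinComb c v))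

_⊑_ : ∀ {n} → Vector n → Vector n → Set
u ⊑ v = ∀ i → (∣ u i ∣ ≤ ∣ v i ∣) × (+ 0 Data.Integer.≤ u i * v i)

IsGraver : ∀ {s t} → Matrix s t → Vector t → Set
IsGraver B x =
  ¬ IsZero x × InKernel B x
  × (∀ y → ¬ IsZero y → InKernel B y → y ⊑ x → ∀ i → y i ≡ x i)

-- Columns are grouped into n blocks of size t (column combine b c = c-th entry of block b);
-- rows: first t rows form (I_t, …, I_t), then n row blocks of size s form diag(A, …, A).
nfold : ∀ {s t} → Matrix s t → (n : ℕ) → Matrix (t +ℕ n *ℕ s) (n *ℕ t)
nfold {s} {t} A n i j with remQuot {n} t j | splitAt t i
... | (b , c) | inj₁ r  = if does (r Fin.≟ c) then + 1 else + 0
... | (b , c) | inj₂ i′ with remQuot {n} s i′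
...   | (b′ , r) = if does (b′ Fin.≟ b) then A r c else + 0

block : ∀ {n t} → Vector (n *ℕ t) → Fin n → Vector t
block x b c = x (combine b c)

nonzero? : ∀ {t} → Vector t → Bool
nonzero? {zero}  x = false
nonzero? {suc t} x = not (does (x zero Data.Integer.≟ + 0)) ∨ nonzero? (λ i → x (suc i))

countTrue : ∀ {n} → (Fin n → Bool) → ℕ
countTrue {zero}  f = 0
countTrue {suc n} f = (if f zero then 1 else 0) +ℕ countTrue (λ i → f (suc i))

type : ∀ {n t} → Vector (n *ℕ t) → ℕ
type {n} {t} x = countTrue (λ b → nonzero? (block {n} {t} x b))

-- "N ≤ g(A)" where g(A) = sup ({0} ∪ {type x : x ∈ G(A^(n)), n ≥ 1}) ∈ ℕ ∪ {∞}
GraverComplexity≥ : ∀ {s t} → Matrix s t → ℕ → Set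
GraverComplexity≥ {s} {t} A N =
  N ≤ 0 ⊎ Σ ℕ (λ n → 1 ≤ n × Σ (Vector (n *ℕ t)) (λ x → IsGraver (nfold A n) x × N ≤ type {n} {t} x))

ones3 : Matrix 1 3
ones3 _ _ = + 1

-- (1,1,1)^(m): incidence matrix of K_{3,m}
K3 : (m : ℕ) → Matrix (3 +ℕ m *ℕ 1) (m *ℕ 3)
K3 m = nfold ones3 m

sumℕ : ∀ {k} → (Fin k → ℕ) → ℕ
sumℕ {zero}  h = 0
sumℕ {suc k} h = h zero +ℕ sumℕ (λ i → h (suc i))

-- The argument works for every integer matrix A.  Put M = ∑ hᵢ and let Y ∈ ℤ^{M t}
-- consist of h₁ blocks equal to x¹, then h₂ blocks equal to x², and so on.  The
-- blocks of Y sum to ∑ hᵢ xⁱ = 0 and lie in ker A, so Y ∈ ker A^(M), and all M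
-- blocks are nonzero, so type Y = M.  For ⊑-minimality take a nonzero z ⊑ Y in
-- ker A^(M).  Each block of z lies in ker A below a circuit, hence is 0 or that
-- circuit (circuit dichotomy).  Counting the kept copies of each xⁱ gives a relation
-- ∑ cᵢ xⁱ = 0 with 0 ≤ cᵢ ≤ hᵢ, and primitivity forces c = 0 or c = h (relation
-- dichotomy), i.e. z = 0 or z = Y.  Both dichotomies rest on one divisibility fact:
-- a·w = b·v with v relatively prime and a ≠ 0 forces a ∣ b.
module Submission where

open import Defs
open import Data.Nat using (ℕ; _≤_)
open import Data.Fin using (Fin)

open import Data.Nat as ℕ using (zero; suc; z≤n; s≤s; NonZero)
import Data.Nat.Properties as ℕP
open import Data.Nat.Divisibility using (_∣_; divides; ∣⇒≤)
open import Data.Nat.DivMod using (_/_; m/n*n≡m)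
open import Data.Nat.GCD using (gcd; gcd[m,n]∣m; gcd[m,n]∣n; gcd[m,n]≢0)
open import Data.Nat.Coprimality using (coprime-/gcd; coprime-divisor)
open import Data.Integer as ℤ using (ℤ; +_; -[1+_]; _+_; _*_; -_; _-_; ∣_∣)
import Data.Integer.Properties as ℤP
open import Data.Integer.Tactic.RingSolver using (solve-∀)
open import Data.Fin as Fin using (zero; suc; _↑ˡ_; _↑ʳ_; splitAt; join; combine; remQuot)
import Data.Fin.Properties as FinP
open import Data.Bool using (Bool; true; if_then_else_)
open import Data.Product using (Σ; _×_; _,_; proj₁; proj₂)
open import Data.Sum using (_⊎_; inj₁; inj₂; [_,_]′)
import Data.Sum as Sum
open import Data.Empty using (⊥-elim)
open import Function using (_∘_)
open import Relation.Nullary using (¬_; Dec; yes; no; does)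
open import Relation.Nullary.Decidable using (dec-true; dec-false; decidable-stable)
open import Relation.Binary.PropositionalEquality

∑-cong : ∀ {n} {f g : Fin n → ℤ} → (∀ i → f i ≡ g i) → ∑ f ≡ ∑ g
∑-cong {zero}  e = refl
∑-cong {suc n} e = cong₂ _+_ (e zero) (∑-cong (e ∘ suc))

∑-zero : ∀ {n} {f : Fin n → ℤ} → (∀ i → f i ≡ + 0) → ∑ f ≡ + 0
∑-zero {zero}  e = refl
∑-zero {suc n} e = cong₂ _+_ (e zero) (∑-zero (e ∘ suc))

∑-linear : ∀ {n} (a b : ℤ) (f g : Fin n → ℤ) →
           ∑ (λ i → a * f i + b * g i) ≡ a * ∑ f + b * ∑ g
∑-linear {zero}  a b f g = sym (cong₂ _+_ (ℤP.*-zeroʳ a) (ℤP.*-zeroʳ b))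
∑-linear {suc n} a b f g =
  trans (cong (_+_ (a * f zero + b * g zero)) (∑-linear a b (f ∘ suc) (g ∘ suc)))
        (regroup a b (f zero) (g zero) (∑ (f ∘ suc)) (∑ (g ∘ suc)))
  where
  regroup : ∀ a b x y X Y → a * x + b * y + (a * X + b * Y) ≡ a * (x + X) + b * (y + Y)
  regroup = solve-∀

∑-combination-vanishes : ∀ {n} (a b : ℤ) {f g F : Fin n → ℤ} →
                         (∀ i → F i ≡ a * f i + b * g i) →
                         ∑ f ≡ + 0 → ∑ g ≡ + 0 → ∑ F ≡ + 0
∑-combination-vanishes a b {f} {g} {F} F≡ f≡0 g≡0 = begin
  ∑ F                          ≡⟨ ∑-cong F≡ ⟩
  ∑ (λ i → a * f i + b * g i)  ≡⟨ ∑-linear a b f g ⟩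
  a * ∑ f + b * ∑ g            ≡⟨ cong₂ (λ p q → a * p + b * q) f≡0 g≡0 ⟩
  a * + 0 + b * + 0            ≡⟨ cong₂ _+_ (ℤP.*-zeroʳ a) (ℤP.*-zeroʳ b) ⟩
  + 0                          ∎
  where open ≡-Reasoning

-- a·b − b·a = 0: the coordinate i₀ of the combinations used in both dichotomies.
commutator-vanishes : ∀ a b → a * b - b * a ≡ + 0
commutator-vanishes = solve-∀

∑-++ : ∀ m {n} (f : Fin (m ℕ.+ n) → ℤ) →
       ∑ f ≡ ∑ (λ i → f (i ↑ˡ n)) + ∑ (λ j → f (m ↑ʳ j))
∑-++ zero    f = sym (ℤP.+-identityˡ _)
∑-++ (suc m) f = trans (cong (_+_ (f zero)) (∑-++ m (f ∘ suc))) (sym (ℤP.+-assoc (f zero) _ _))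

∑-blocks : ∀ n t (f : Fin (n ℕ.* t) → ℤ) →
           ∑ f ≡ ∑ (λ b → ∑ (λ c → f (combine {n} {t} b c)))
∑-blocks zero    t f = refl
∑-blocks (suc n) t f =
  trans (∑-++ t f) (cong (_+_ (∑ (λ c → f (c ↑ˡ n ℕ.* t)))) (∑-blocks n t (λ i → f (t ↑ʳ i))))

∑-δ : ∀ {n} (r : Fin n) (f : Fin n → ℤ) → (∀ c → r ≢ c → f c ≡ + 0) → ∑ f ≡ f r
∑-δ zero    f off = trans (cong (_+_ (f zero)) (∑-zero (λ c → off (suc c) λ ()))) (ℤP.+-identityʳ _)
∑-δ (suc r) f off =
  trans (cong₂ _+_ (off zero λ ()) (∑-δ r (f ∘ suc) (λ c r≢c → off (suc c) (r≢c ∘ FinP.suc-injective))))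
        (ℤP.+-identityˡ _)

∑-count : ∀ {n} (e : Fin n → ℕ) (X : ℤ) → ∑ (λ j → + e j * X) ≡ + sumℕ e * X
∑-count {zero}  e X = refl
∑-count {suc n} e X =
  trans (cong (_+_ (+ e zero * X)) (∑-count (e ∘ suc) X))
        (sym (ℤP.*-distribʳ-+ X (+ e zero) (+ sumℕ (e ∘ suc))))

sumℕ-bits-≤ : ∀ {n} (e : Fin n → ℕ) → (∀ j → e j ≤ 1) → sumℕ e ≤ n
sumℕ-bits-≤ {zero}  e e≤1 = z≤n
sumℕ-bits-≤ {suc n} e e≤1 = ℕP.+-mono-≤ (e≤1 zero) (sumℕ-bits-≤ (e ∘ suc) (e≤1 ∘ suc))

sumℕ≡0 : ∀ {n} (e : Fin n → ℕ) → sumℕ e ≡ 0 → ∀ j → e j ≡ 0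
sumℕ≡0 e total zero    = ℕP.m+n≡0⇒m≡0 (e zero) total
sumℕ≡0 e total (suc j) = sumℕ≡0 (e ∘ suc) (ℕP.m+n≡0⇒n≡0 (e zero) total) j

sumℕ-bits-full : ∀ {n} (e : Fin n → ℕ) → (∀ j → e j ≤ 1) → sumℕ e ≡ n → ∀ j → e j ≡ 1
sumℕ-bits-full {suc n} e e≤1 total = λ { zero → e₀≡1 ; (suc j) → sumℕ-bits-full (e ∘ suc) (e≤1 ∘ suc) rest≡n j }
  where
  rest = sumℕ (e ∘ suc)
  1≤e₀ : 1 ≤ e zero
  1≤e₀ = ℕP.+-cancelʳ-≤ n 1 (e zero)
           (subst (_≤ e zero ℕ.+ n) total (ℕP.+-monoʳ-≤ (e zero) (sumℕ-bits-≤ (e ∘ suc) (e≤1 ∘ suc))))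
  e₀≡1 : e zero ≡ 1
  e₀≡1 = ℕP.≤-antisym (e≤1 zero) 1≤e₀
  rest≡n : rest ≡ n
  rest≡n = ℕP.suc-injective (trans (cong (ℕ._+ rest) (sym e₀≡1)) total)

sumℕ-ones : ∀ n → sumℕ {n} (λ _ → 1) ≡ n
sumℕ-ones zero    = refl
sumℕ-ones (suc n) = cong suc (sumℕ-ones n)

isZero? : ∀ {n} (v : Vector n) → Dec (IsZero v)
isZero? v = FinP.all? (λ i → v i ℤ.≟ + 0)

nonzero-coordinate : ∀ {n} (v : Vector n) → ¬ IsZero v → Σ (Fin n) (λ i → v i ≢ + 0)
nonzero-coordinate {n} v = FinP.¬∀⟶∃¬ n (λ i → v i ≡ + 0) (λ i → v i ℤ.≟ + 0)

blocks-determine : ∀ {n t} (u v : Vector (n ℕ.* t)) →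
                   (∀ b c → block {n} {t} u b c ≡ block {n} {t} v b c) → ∀ j → u j ≡ v j
blocks-determine {n} {t} u v same j = subst (λ q → u q ≡ v q) (FinP.combine-remQuot {n} t j) (same _ _)

nonzero?-complete : ∀ {t} (v : Vector t) → ¬ IsZero v → nonzero? v ≡ true
nonzero?-complete {zero}  v v≢0 = ⊥-elim (v≢0 λ ())
nonzero?-complete {suc t} v v≢0 with v zero ℤ.≟ + 0
... | no _     = refl
... | yes v₀≡0 = nonzero?-complete (v ∘ suc) λ tail≡0 → v≢0 λ { zero → v₀≡0 ; (suc i) → tail≡0 i }

countTrue-all : ∀ {n} (f : Fin n → Bool) → (∀ b → f b ≡ true) → countTrue f ≡ n
countTrue-all {zero}  f all = refl
countTrue-all {suc n} f all rewrite all zero = cong suc (countTrue-all (f ∘ suc) (all ∘ suc))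

type-full : ∀ {n t} (z : Vector (n ℕ.* t)) → (∀ b → ¬ IsZero (block {n} {t} z b)) → type {n} {t} z ≡ n
type-full z nonzero = countTrue-all _ (λ b → nonzero?-complete _ (nonzero b))

select-≡ : ∀ {n} (r : Fin n) (u v : ℤ) → (if does (r Fin.≟ r) then u else v) ≡ u
select-≡ r u v = cong (λ d → if d then u else v) (dec-true (r Fin.≟ r) refl)

select-≢ : ∀ {n} {r c : Fin n} (u v : ℤ) → r ≢ c → (if does (r Fin.≟ c) then u else v) ≡ v
select-≢ {r = r} {c} u v r≢c = cong (λ d → if d then u else v) (dec-false (r Fin.≟ c) r≢c)

module NFold {s t} (A : Matrix s t) (n : ℕ) where

  identity-entry : ∀ r b c →
    nfold A n (r ↑ˡ (n ℕ.* s)) (combine b c) ≡ (if does (r Fin.≟ c) then + 1 else + 0)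
  identity-entry r b c
    with remQuot {n} t (combine b c) | FinP.remQuot-combine {n} {t} b c
       | splitAt t {n ℕ.* s} (r ↑ˡ (n ℕ.* s)) | FinP.splitAt-↑ˡ t r (n ℕ.* s)
  ... | .(b , c) | refl | .(inj₁ r) | refl = refl

  diagonal-entry : ∀ b′ r b c →
    nfold A n (t ↑ʳ combine b′ r) (combine b c) ≡ (if does (b′ Fin.≟ b) then A r c else + 0)
  diagonal-entry b′ r b c
    with remQuot {n} t (combine b c) | FinP.remQuot-combine {n} {t} b c
       | splitAt t {n ℕ.* s} (t ↑ʳ combine b′ r) | FinP.splitAt-↑ʳ t (n ℕ.* s) (combine b′ r)
  ... | .(b , c) | refl | .(inj₂ (combine b′ r)) | refl =
    cong (λ p → if does (proj₁ p Fin.≟ b) then A (proj₂ p) c else + 0) (FinP.remQuot-combine {n} {s} b′ r)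

  sum-row : ∀ (z : Vector (n ℕ.* t)) r →
            (nfold A n · z) (r ↑ˡ (n ℕ.* s)) ≡ ∑ (λ b → block {n} {t} z b r)
  sum-row z r = begin
    (nfold A n · z) (r ↑ˡ (n ℕ.* s))
      ≡⟨ ∑-blocks n t _ ⟩
    ∑ (λ b → ∑ (λ c → nfold A n (r ↑ˡ (n ℕ.* s)) (combine b c) * zb b c))
      ≡⟨ ∑-cong (λ b → ∑-cong (λ c → cong (_* zb b c) (identity-entry r b c))) ⟩
    ∑ (λ b → ∑ (λ c → (if does (r Fin.≟ c) then + 1 else + 0) * zb b c))
      ≡⟨ ∑-cong (λ b → ∑-δ r _ (λ c r≢c → cong (_* zb b c) (select-≢ (+ 1) (+ 0) r≢c))) ⟩
    ∑ (λ b → (if does (r Fin.≟ r) then + 1 else + 0) * zb b r)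
      ≡⟨ ∑-cong (λ b → trans (cong (_* zb b r) (select-≡ r (+ 1) (+ 0))) (ℤP.*-identityˡ _)) ⟩
    ∑ (λ b → zb b r) ∎
    where
    open ≡-Reasoning
    zb = block {n} {t} z

  block-row : ∀ (z : Vector (n ℕ.* t)) b′ r →
              (nfold A n · z) (t ↑ʳ combine b′ r) ≡ (A · block {n} {t} z b′) r
  block-row z b′ r = begin
    (nfold A n · z) (t ↑ʳ combine b′ r)
      ≡⟨ ∑-blocks n t _ ⟩
    ∑ (λ b → ∑ (λ c → nfold A n (t ↑ʳ combine b′ r) (combine b c) * zb b c))
      ≡⟨ ∑-cong (λ b → ∑-cong (λ c → cong (_* zb b c) (diagonal-entry b′ r b c))) ⟩
    ∑ (λ b → ∑ (λ c → (if does (b′ Fin.≟ b) then A r c else + 0) * zb b c))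
      ≡⟨ ∑-δ b′ _ (λ b b′≢b → ∑-zero (λ c → cong (_* zb b c) (select-≢ (A r c) (+ 0) b′≢b))) ⟩
    ∑ (λ c → (if does (b′ Fin.≟ b′) then A r c else + 0) * zb b′ c)
      ≡⟨ ∑-cong (λ c → cong (_* zb b′ c) (select-≡ b′ (A r c) (+ 0))) ⟩
    (A · zb b′) r ∎
    where
    open ≡-Reasoning
    zb = block {n} {t} z

  kernel-intro : ∀ (z : Vector (n ℕ.* t)) →
                 (∀ r → ∑ (λ b → block {n} {t} z b r) ≡ + 0) →
                 (∀ b → InKernel A (block {n} {t} z b)) → InKernel (nfold A n) z
  kernel-intro z sums blocks i =
    subst (λ j → (nfold A n · z) j ≡ + 0) (FinP.join-splitAt t (n ℕ.* s) i) (row (splitAt t i))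
    where
    row : (u : Fin t ⊎ Fin (n ℕ.* s)) → (nfold A n · z) (join t (n ℕ.* s) u) ≡ + 0
    row (inj₁ r)  = trans (sum-row z r) (sums r)
    row (inj₂ i′) = subst (λ q → (nfold A n · z) (t ↑ʳ q) ≡ + 0) (FinP.combine-remQuot {n} s i′)
                          (trans (block-row z _ _) (blocks _ _))

  kernel-sums : ∀ (z : Vector (n ℕ.* t)) → InKernel (nfold A n) z →
                ∀ r → ∑ (λ b → block {n} {t} z b r) ≡ + 0
  kernel-sums z z∈ker r = trans (sym (sum-row z r)) (z∈ker _)

  kernel-blocks : ∀ (z : Vector (n ℕ.* t)) → InKernel (nfold A n) z →
                  ∀ b → InKernel A (block {n} {t} z b)
  kernel-blocks z z∈ker b r = trans (sym (block-row z b r)) (z∈ker _)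

-- If a·wᵢ = b·vᵢ for all i, with a ≠ 0 and the vᵢ relatively prime, then a ∣ b:
-- with g = gcd(a,b), a/g is coprime to b/g and divides every (b/g)·vᵢ, so a/g = 1.
divides-of-proportional : ∀ {N} (a b : ℕ) {{_ : NonZero a}} (v w : Fin N → ℕ) →
                          RelPrime v → (∀ i → a ℕ.* w i ≡ b ℕ.* v i) → a ∣ b
divides-of-proportional a b v w v-prime prop = subst (_∣ b) (sym a≡g) (gcd[m,n]∣n a b)
  where
  g = gcd a b
  instance
    g≢0 : NonZero g
    g≢0 = ℕ.≢-nonZero (gcd[m,n]≢0 a b (inj₁ (ℕ.≢-nonZero⁻¹ a)))
  a′ = a / g
  b′ = b / g
  a′*g≡a : a′ ℕ.* g ≡ a
  a′*g≡a = m/n*n≡m (gcd[m,n]∣m a b)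
  b′*g≡b : b′ ℕ.* g ≡ b
  b′*g≡b = m/n*n≡m (gcd[m,n]∣n a b)
  reduced : ∀ i → a′ ℕ.* w i ≡ b′ ℕ.* v i
  reduced i = ℕP.*-cancelʳ-≡ _ _ g (begin
    a′ ℕ.* w i ℕ.* g  ≡⟨ ℕP.*-assoc a′ (w i) g ⟩
    a′ ℕ.* (w i ℕ.* g) ≡⟨ cong (a′ ℕ.*_) (ℕP.*-comm (w i) g) ⟩
    a′ ℕ.* (g ℕ.* w i) ≡⟨ sym (ℕP.*-assoc a′ g (w i)) ⟩
    a′ ℕ.* g ℕ.* w i  ≡⟨ cong (ℕ._* w i) a′*g≡a ⟩
    a ℕ.* w i         ≡⟨ prop i ⟩
    b ℕ.* v i         ≡⟨ cong (ℕ._* v i) (sym b′*g≡b) ⟩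
    b′ ℕ.* g ℕ.* v i  ≡⟨ ℕP.*-assoc b′ g (v i) ⟩
    b′ ℕ.* (g ℕ.* v i) ≡⟨ cong (b′ ℕ.*_) (ℕP.*-comm g (v i)) ⟩
    b′ ℕ.* (v i ℕ.* g) ≡⟨ sym (ℕP.*-assoc b′ (v i) g) ⟩
    b′ ℕ.* v i ℕ.* g  ∎)
    where open ≡-Reasoning
  a′∣v : ∀ i → a′ ∣ v i
  a′∣v i = coprime-divisor (coprime-/gcd a b)
             (divides (w i) (trans (sym (reduced i)) (ℕP.*-comm a′ (w i))))
  a≡g : a ≡ g
  a≡g = trans (sym a′*g≡a) (trans (cong (ℕ._* g) (v-prime a′ a′∣v)) (ℕP.*-identityˡ g))

proportional-dichotomy : ∀ {N} (a b : ℕ) {{_ : NonZero a}} (v w : Fin N → ℕ) →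
                         RelPrime v → b ≤ a → (∀ i → a ℕ.* w i ≡ b ℕ.* v i) → b ≡ 0 ⊎ b ≡ a
proportional-dichotomy a zero    v w v-prime b≤a prop = inj₁ refl
proportional-dichotomy a (suc b) v w v-prime b≤a prop =
  inj₂ (ℕP.≤-antisym b≤a (∣⇒≤ (divides-of-proportional a (suc b) v w v-prime prop)))

same-sign-same-abs : ∀ a b → ∣ b ∣ ≡ ∣ a ∣ → + 0 ℤ.≤ b * a → b ≡ a
same-sign-same-abs (+ p)    (+ q)    same _ = cong +_ same
same-sign-same-abs (+ .(suc q)) -[1+ q ] refl ()
same-sign-same-abs -[1+ p ] (+ .(suc p)) refl ()
same-sign-same-abs -[1+ p ] -[1+ q ] same _ = cong -[1+_] (ℕP.suc-injective same)

-- For a coordinate i₀ with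
-- zᵢ₀ ≠ 0, the kernel vector w = xᵢ₀·z − zᵢ₀·x has support inside supp x but misses
-- i₀, so w = 0 by minimality of supp x; thus xᵢ₀·z = zᵢ₀·x, and relative primality
-- of x with |zᵢ₀| ≤ |xᵢ₀| and equal signs gives zᵢ₀ = xᵢ₀, hence z = x.
circuit-dichotomy : ∀ {s t} (B : Matrix s t) (x z : Vector t) → IsCircuit B x →
                    InKernel B z → z ⊑ x → IsZero z ⊎ (∀ i → z i ≡ x i)
circuit-dichotomy {t = t} B x z (_ , Bx≡0 , minimal , x-prime) Bz≡0 z⊑x with isZero? z
... | yes z≡0 = inj₁ z≡0
... | no  z≢0 = inj₂ z≡x
  where
  i₀ = proj₁ (nonzero-coordinate z z≢0)
  zᵢ₀≢0 = proj₂ (nonzero-coordinate z z≢0)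
  a = x i₀
  b = z i₀
  below-zero : ∀ i → x i ≡ + 0 → z i ≡ + 0
  below-zero i xᵢ≡0 =
    ℤP.∣i∣≡0⇒i≡0 (ℕP.n≤0⇒n≡0 (subst (∣ z i ∣ ≤_) (cong ∣_∣ xᵢ≡0) (proj₁ (z⊑x i))))
  a≢0 : a ≢ + 0
  a≢0 = zᵢ₀≢0 ∘ below-zero i₀
  w : Vector t
  w i = a * z i - b * x i
  distrib : ∀ p a q b c → p * (a * q - b * c) ≡ a * (p * q) + (- b) * (p * c)
  distrib = solve-∀
  Bw≡0 : InKernel B w
  Bw≡0 r = ∑-combination-vanishes a (- b) (λ j → distrib (B r j) a (z j) b (x j)) (Bz≡0 r) (Bx≡0 r)
  w-inside : SuppSub w x
  w-inside i wᵢ≢0 xᵢ≡0 = wᵢ≢0 (begin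
    a * z i - b * x i    ≡⟨ cong₂ (λ p q → a * p - b * q) (below-zero i xᵢ≡0) xᵢ≡0 ⟩
    a * + 0 - b * + 0    ≡⟨ cong₂ (λ p q → p - q) (ℤP.*-zeroʳ a) (ℤP.*-zeroʳ b) ⟩
    + 0                  ∎)
    where open ≡-Reasoning
  w≡0 : IsZero w
  w≡0 = decidable-stable (isZero? w)
          (λ w≢0 → minimal w w≢0 Bw≡0 w-inside i₀ a≢0 (commutator-vanishes a b))
  proportional : ∀ i → a * z i ≡ b * x i
  proportional i = ℤP.i-j≡0⇒i≡j _ _ (w≡0 i)
  ∣proportional∣ : ∀ i → ∣ a ∣ ℕ.* ∣ z i ∣ ≡ ∣ b ∣ ℕ.* ∣ x i ∣
  ∣proportional∣ i = trans (sym (ℤP.abs-* a (z i))) (trans (cong ∣_∣ (proportional i)) (ℤP.abs-* b (x i)))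
  instance
    ∣a∣≢0 : NonZero ∣ a ∣
    ∣a∣≢0 = ℕ.≢-nonZero (a≢0 ∘ ℤP.∣i∣≡0⇒i≡0)
  b≡a : b ≡ a
  b≡a with proportional-dichotomy ∣ a ∣ ∣ b ∣ (∣_∣ ∘ x) (∣_∣ ∘ z) x-prime (proj₁ (z⊑x i₀)) ∣proportional∣
  ... | inj₁ ∣b∣≡0    = ⊥-elim (zᵢ₀≢0 (ℤP.∣i∣≡0⇒i≡0 ∣b∣≡0))
  ... | inj₂ ∣b∣≡∣a∣ = same-sign-same-abs a b ∣b∣≡∣a∣ (proj₂ (z⊑x i₀))
  z≡x : ∀ i → z i ≡ x i
  z≡x i = ℤP.*-cancelˡ-≡ a (z i) (x i) (trans (proportional i) (cong (_* x i) b≡a))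

-- A sub-relation 0 ≤ cᵢ ≤ hᵢ of a primitive relation ∑ hᵢ vⁱ = 0 is 0 or the whole
-- relation: hᵢ₀·c − cᵢ₀·h is a relation vanishing at i₀, hence zero by primitivity,
-- so c is proportional to h, and relative primality of h leaves cᵢ₀ ∈ {0, hᵢ₀}.
relation-dichotomy : ∀ {k N} (v : Fin k → Vector N) (h : Fin k → ℕ) →
                     IsPrimitiveRelation h v → (i₀ : Fin k) →
                     (c : Fin k → ℕ) → (∀ i → c i ≤ h i) → IsZero (LinComb (λ i → + c i) v) →
                     (∀ i → c i ≡ 0) ⊎ (∀ i → c i ≡ h i)
relation-dichotomy v h (h≥1 , h-prime , h-rel , independent) i₀ c c≤h c-rel =
  Sum.map none all (proportional-dichotomy (h i₀) (c i₀) h c h-prime (c≤h i₀) proportional)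
  where
  instance
    hᵢ₀≢0 : NonZero (h i₀)
    hᵢ₀≢0 = ℕ.>-nonZero (h≥1 i₀)
  d : Fin _ → ℤ
  d i = + h i₀ * + c i - + c i₀ * + h i
  distrib : ∀ p q r s X → (p * q - r * s) * X ≡ p * (q * X) + (- r) * (s * X)
  distrib = solve-∀
  d-rel : IsZero (LinComb d v)
  d-rel j = ∑-combination-vanishes (+ h i₀) (- + c i₀)
              (λ i → distrib (+ h i₀) (+ c i) (+ c i₀) (+ h i) (v i j)) (c-rel j) (h-rel j)
  d≡0 : IsZero d
  d≡0 = decidable-stable (isZero? d)
          (λ d≢0 → independent i₀ d (commutator-vanishes (+ h i₀) (+ c i₀)) d≢0 d-rel)
  proportional : ∀ i → h i₀ ℕ.* c i ≡ c i₀ ℕ.* h i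
  proportional i = trans (sym (ℤP.abs-* (+ h i₀) (+ c i)))
                     (trans (cong ∣_∣ (ℤP.i-j≡0⇒i≡j (+ h i₀ * + c i) (+ c i₀ * + h i) (d≡0 i))) (ℤP.abs-* (+ c i₀) (+ h i)))
  none : c i₀ ≡ 0 → ∀ i → c i ≡ 0
  none cᵢ₀≡0 i = ℕP.*-cancelˡ-≡ (c i) 0 (h i₀)
    (trans (proportional i) (trans (cong (ℕ._* h i) cᵢ₀≡0) (sym (ℕP.*-zeroʳ (h i₀)))))
  all : c i₀ ≡ h i₀ → ∀ i → c i ≡ h i
  all cᵢ₀≡hᵢ₀ i = ℕP.*-cancelˡ-≡ (c i) (h i) (h i₀) (trans (proportional i) (cong (ℕ._* h i) cᵢ₀≡hᵢ₀))

-- The blocks of ℤ^{(∑ h) t} are grouped consecutively: h₀ blocks form group 0,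
-- the next h₁ blocks form group 1, and so on; `owner` gives the group of a block.
owner : ∀ {k} (h : Fin k → ℕ) → Fin (sumℕ h) → Fin k
owner {suc k} h b with splitAt (h zero) b
... | inj₁ _  = zero
... | inj₂ b′ = suc (owner (h ∘ suc) b′)

copy : ∀ {k} (h : Fin k → ℕ) (i : Fin k) → Fin (h i) → Fin (sumℕ h)
copy {suc k} h zero    j = j ↑ˡ sumℕ (h ∘ suc)
copy {suc k} h (suc i) j = h zero ↑ʳ copy (h ∘ suc) i j

owner-copy : ∀ {k} (h : Fin k → ℕ) i j → owner h (copy h i j) ≡ i
owner-copy {suc k} h zero j rewrite FinP.splitAt-↑ˡ (h zero) j (sumℕ (h ∘ suc)) = refl
owner-copy {suc k} h (suc i) j rewrite FinP.splitAt-↑ʳ (h zero) (sumℕ (h ∘ suc)) (copy (h ∘ suc) i j) =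
  cong suc (owner-copy (h ∘ suc) i j)

copy-surjective : ∀ {k} (h : Fin k → ℕ) b → Σ (Fin k) (λ i → Σ (Fin (h i)) (λ j → copy h i j ≡ b))
copy-surjective {suc k} h b = from-split (splitAt (h zero) b) (FinP.join-splitAt (h zero) _ b)
  where
  from-split : (u : Fin (h zero) ⊎ Fin (sumℕ (h ∘ suc))) → join (h zero) _ u ≡ b →
               Σ (Fin (suc k)) (λ i → Σ (Fin (h i)) (λ j → copy h i j ≡ b))
  from-split (inj₁ j)  e = zero , j , e
  from-split (inj₂ b′) e with copy-surjective (h ∘ suc) b′
  ... | i , j , e′ = suc i , j , trans (cong (h zero ↑ʳ_) e′) e

∑-by-groups : ∀ {k} (h : Fin k → ℕ) (G : Fin (sumℕ h) → ℤ) →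
              ∑ G ≡ ∑ (λ i → ∑ (λ j → G (copy h i j)))
∑-by-groups {zero}  h G = refl
∑-by-groups {suc k} h G =
  trans (∑-++ (h zero) G) (cong (_+_ (∑ (λ j → G (j ↑ˡ sumℕ (h ∘ suc))))) (∑-by-groups (h ∘ suc) (G ∘ (h zero ↑ʳ_))))

multiplicity : ∀ {k} (h : Fin k → ℕ) → (Fin (sumℕ h) → ℕ) → Fin k → ℕ
multiplicity h e i = sumℕ (λ j → e (copy h i j))

∑-gather : ∀ {k t} (h : Fin k → ℕ) (x : Fin k → Vector t) (e : Fin (sumℕ h) → ℕ) c →
           ∑ (λ b → + e b * x (owner h b) c) ≡ LinComb (λ i → + multiplicity h e i) x c
∑-gather h x e c = begin
  ∑ (λ b → + e b * x (owner h b) c)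
    ≡⟨ ∑-by-groups h _ ⟩
  ∑ (λ i → ∑ (λ j → + e (copy h i j) * x (owner h (copy h i j)) c))
    ≡⟨ ∑-cong (λ i → ∑-cong (λ j → cong (λ q → + e (copy h i j) * x q c) (owner-copy h i j))) ⟩
  ∑ (λ i → ∑ (λ j → + e (copy h i j) * x i c))
    ≡⟨ ∑-cong (λ i → ∑-count (λ j → e (copy h i j)) (x i c)) ⟩
  LinComb (λ i → + multiplicity h e i) x c ∎
  where open ≡-Reasoning

indicator : ∀ {t} {v w : Vector t} → IsZero v ⊎ (∀ c → v c ≡ w c) → ℕ
indicator (inj₁ _) = 0
indicator (inj₂ _) = 1

indicator-≤1 : ∀ {t} {v w : Vector t} (d : IsZero v ⊎ (∀ c → v c ≡ w c)) → indicator d ≤ 1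
indicator-≤1 (inj₁ _) = z≤n
indicator-≤1 (inj₂ _) = s≤s z≤n

indicator-scales : ∀ {t} {v w : Vector t} (d : IsZero v ⊎ (∀ c → v c ≡ w c)) → ∀ c → v c ≡ + indicator d * w c
indicator-scales (inj₁ v≡0) c = v≡0 c
indicator-scales (inj₂ v≡w) c = trans (v≡w c) (sym (ℤP.*-identityˡ _))

-- The vector Y consisting of h₀ copies of x⁰, then h₁ copies of x¹, …; the index i₀
-- only serves to know that some group, hence Y, is nonempty.
module Repetition {s t} (A : Matrix s t) {k} (x : Fin k → Vector t)
                  (circuits : ∀ i → IsCircuit A (x i))
                  (h : Fin k → ℕ) (primitivity : IsPrimitiveRelation h x) (i₀ : Fin k) where

  M : ℕ
  M = sumℕ h

  open NFold A M

  Y : Vector (M ℕ.* t)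
  Y j = x (owner h (proj₁ (remQuot {M} t j))) (proj₂ (remQuot {M} t j))

  block-Y : ∀ b c → block {M} {t} Y b c ≡ x (owner h b) c
  block-Y b c = cong (λ p → x (owner h (proj₁ p)) (proj₂ p)) (FinP.remQuot-combine {M} {t} b c)

  blocks-nonzero : ∀ b → ¬ IsZero (block {M} {t} Y b)
  blocks-nonzero b Yᵦ≡0 = proj₁ (circuits (owner h b)) (λ c → trans (sym (block-Y b c)) (Yᵦ≡0 c))

  some-block : Fin M
  some-block = copy h i₀ (Fin.fromℕ< (proj₁ primitivity i₀))

  Y-nonzero : ¬ IsZero Y
  Y-nonzero Y≡0 = blocks-nonzero some-block (λ c → Y≡0 (combine {M} {t} some-block c))

  Y-kernel : InKernel (nfold A M) Y
  Y-kernel = kernel-intro Y sums (λ b r → trans (∑-cong (λ c → cong (A r c *_) (block-Y b c)))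
                                                (proj₁ (proj₂ (circuits (owner h b))) r))
    where
    sums : ∀ r → ∑ (λ b → block {M} {t} Y b r) ≡ + 0
    sums r = begin
      ∑ (λ b → block {M} {t} Y b r)          ≡⟨ ∑-cong (λ b → trans (block-Y b r) (sym (ℤP.*-identityˡ _))) ⟩
      ∑ (λ b → + 1 * x (owner h b) r)         ≡⟨ ∑-gather h x (λ _ → 1) r ⟩
      LinComb (λ i → + multiplicity h (λ _ → 1) i) x r
                                              ≡⟨ ∑-cong (λ i → cong (λ q → + q * x i r) (sumℕ-ones (h i))) ⟩
      LinComb (λ i → + h i) x r               ≡⟨ proj₁ (proj₂ (proj₂ primitivity)) r ⟩
      + 0                                     ∎
      where open ≡-Reasoning

  -- Each block of z is 0 or the circuit
  -- x^{owner b}; the numbers of kept copies form a sub-relation of ∑ hᵢ xⁱ, which by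
  -- primitivity keeps no copy (impossible as z ≠ 0) or every copy (z = Y).
  Y-minimal : ∀ z → ¬ IsZero z → InKernel (nfold A M) z → z ⊑ Y → ∀ j → z j ≡ Y j
  Y-minimal z z≢0 z∈ker z⊑Y =
    [ (λ none → ⊥-elim (z≢0 (blocks-determine z (λ _ → + 0) (kept-none none))))
    , (λ all → blocks-determine z Y (kept-all all)) ]′
    (relation-dichotomy x h primitivity i₀ (multiplicity h e) multiplicity≤h multiplicity-rel)
    where
    below : ∀ b → block {M} {t} z b ⊑ x (owner h b)
    below b c = subst (λ q → (∣ z (combine {M} {t} b c) ∣ ≤ ∣ q ∣) × (+ 0 ℤ.≤ z (combine {M} {t} b c) * q))
                      (block-Y b c) (z⊑Y (combine {M} {t} b c))
    kept : ∀ b → IsZero (block {M} {t} z b) ⊎ (∀ c → block {M} {t} z b c ≡ x (owner h b) c)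
    kept b = circuit-dichotomy A (x (owner h b)) _ (circuits (owner h b)) (kernel-blocks z z∈ker b) (below b)
    e : Fin M → ℕ
    e b = indicator (kept b)
    multiplicity≤h : ∀ i → multiplicity h e i ≤ h i
    multiplicity≤h i = sumℕ-bits-≤ _ (λ j → indicator-≤1 (kept (copy h i j)))
    multiplicity-rel : IsZero (LinComb (λ i → + multiplicity h e i) x)
    multiplicity-rel r = begin
      LinComb (λ i → + multiplicity h e i) x r ≡⟨ sym (∑-gather h x e r) ⟩
      ∑ (λ b → + e b * x (owner h b) r)        ≡⟨ ∑-cong (λ b → sym (indicator-scales (kept b) r)) ⟩
      ∑ (λ b → block {M} {t} z b r)            ≡⟨ kernel-sums z z∈ker r ⟩
      + 0                                      ∎
      where open ≡-Reasoning
    every-block : (P : ℕ → Set) → (∀ i j → P (e (copy h i j))) → ∀ b → P (e b)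
    every-block P groupwise b with copy-surjective h b
    ... | i , j , copy≡b = subst (P ∘ e) copy≡b (groupwise i j)
    kept-none : (∀ i → multiplicity h e i ≡ 0) → ∀ b c → block {M} {t} z b c ≡ + 0
    kept-none none b c = trans (indicator-scales (kept b) c)
      (cong (λ q → + q * x (owner h b) c) (every-block (_≡ 0) (λ i → sumℕ≡0 _ (none i)) b))
    kept-all : (∀ i → multiplicity h e i ≡ h i) → ∀ b c → block {M} {t} z b c ≡ block {M} {t} Y b c
    kept-all all b c = begin
      block {M} {t} z b c          ≡⟨ indicator-scales (kept b) c ⟩
      + e b * x (owner h b) c      ≡⟨ cong (λ q → + q * x (owner h b) c) (every-block (_≡ 1) full b) ⟩
      + 1 * x (owner h b) c        ≡⟨ ℤP.*-identityˡ _ ⟩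
      x (owner h b) c              ≡⟨ sym (block-Y b c) ⟩
      block {M} {t} Y b c          ∎
      where
      open ≡-Reasoning
      full : ∀ i j → e (copy h i j) ≡ 1
      full i = sumℕ-bits-full _ (λ j → indicator-≤1 (kept (copy h i j))) (all i)

  Y-graver : IsGraver (nfold A M) Y
  Y-graver = Y-nonzero , Y-kernel , Y-minimal

  type-Y : type {M} {t} Y ≡ M
  type-Y = type-full Y blocks-nonzero

primitivity-relation-bound : ∀ {s t} (A : Matrix s t) {k} (x : Fin k → Vector t) →
                           (∀ i → IsCircuit A (x i)) → (h : Fin k → ℕ) →
                           IsPrimitiveRelation h x → GraverComplexity≥ A (sumℕ h)
primitivity-relation-bound A {zero}  x circuits h primitivity = inj₁ z≤n
primitivity-relation-bound A {suc k} x circuits h primitivity =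
  inj₂ (M , ℕP.≤-trans (s≤s z≤n) (FinP.toℕ<n some-block) , Y , Y-graver , ℕP.≤-reflexive (sym type-Y))
  where open Repetition A x circuits h primitivity zero

proposition2p3 : (m : ℕ) → 1 ≤ m → (k : ℕ) → (x : Fin k → Vector (m Data.Nat.* 3))
    → (∀ i → IsCircuit (K3 m) (x i))
    → (h : Fin k → ℕ) → IsPrimitiveRelation h x
    → GraverComplexity≥ (K3 m) (sumℕ h)
proposition2p3 m _ k x circuits h primitivity = primitivity-relation-bound (K3 m) x circuits h primitivity
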